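{- Let $m\ge 1$, $n\ge 1$ and $1\le k\le m$. The number of words of length $n$ on $\{1,\dots,m\}$ that avoid both generalized patterns $1-21$ and $2-12$ and have exactly $k$ distinct letters is \[ \binom{m}{k}\,k\cdot (n-1)_{k-1}, \] where $(a)_b=a(a-1)\cdots(a-b+1)$ is the falling factorial (with $(a)_0=1$).
   Context: A word of length $n$ on $\{1,\dots,m\}$ (naturally ordered) is a sequence $w_1\cdots w_n$ of elements of $\{1,\dots,m\}$. A word $w$ contains the generalized pattern $1-21$ iff there exist indices $1\le i<j<n$ with $w_i=w_{j+1}<w_j$, and contains $2-12$ iff there exist $i<j<n$ with $w_i=w_{j+1}>w_j$; it avoids a pattern if it does not contain it. -}

module Defs where

open import Data.Nat using (ℕ; zero; suc; _*_; _∸_; _<_)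
open import Data.Fin using (Fin; zero; suc; toℕ; inject₁)
open import Data.Fin.Properties using (any?; _≟_)
open import Data.List using (List; []; _∷_; length; filter; concatMap; map)
open import Data.List.Base using (allFin)
open import Data.Product using (∃; ∃-syntax; _×_; _,_)
open import Relation.Nullary using (¬_; Dec; ¬?)
open import Relation.Nullary.Decidable using (_×-dec_)
open import Relation.Binary.PropositionalEquality using (_≡_)
import Data.Fin as F

-- A word of length n on the alphabet {1,…,m} is a map Fin n → Fin m
-- (letter j ∈ Fin m stands for j+1; the order on Fin m is the natural one).
Word : ℕ → ℕ → Set
Word m n = Fin n → Fin m

allWords : (m n : ℕ) → List (Word m n)
allWords m zero = (λ ()) ∷ []
allWords m (suc n) =
  concatMap (λ a → map (λ w → λ { zero → a ; (suc i) → w i }) (allWords m n)) (allFin m)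

-- w contains 1-21: ∃ i < j < n-1 (0-based: positions i, j, j+1) with
-- w i = w (j+1) < w j.   Here j ranges over Fin n' when the length is suc n',
-- so that j and j+1 are both positions.
Contains1-21 : ∀ {m n} → Word m (suc n) → Set
Contains1-21 {m} {n} w =
  ∃[ i ] ∃[ j ] (i F.< inject₁ j × w i ≡ w (suc j) × w (suc j) F.< w (inject₁ j))

Contains2-12 : ∀ {m n} → Word m (suc n) → Set
Contains2-12 {m} {n} w =
  ∃[ i ] ∃[ j ] (i F.< inject₁ j × w i ≡ w (suc j) × w (inject₁ j) F.< w (suc j))

contains1-21? : ∀ {m n} (w : Word m (suc n)) → Dec (Contains1-21 w)
contains1-21? w = any? λ i → any? λ j →
  (i F.<? inject₁ j) ×-dec ((w i ≟ w (suc j)) ×-dec (w (suc j) F.<? w (inject₁ j)))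

contains2-12? : ∀ {m n} (w : Word m (suc n)) → Dec (Contains2-12 w)
contains2-12? w = any? λ i → any? λ j →
  (i F.<? inject₁ j) ×-dec ((w i ≟ w (suc j)) ×-dec (w (inject₁ j) F.<? w (suc j)))

Occurs : ∀ {m n} → Fin m → Word m n → Set
Occurs a w = ∃[ i ] w i ≡ a

occurs? : ∀ {m n} (a : Fin m) (w : Word m n) → Dec (Occurs a w)
occurs? a w = any? λ i → w i ≟ a

distinctLetters : ∀ {m n} → Word m n → ℕ
distinctLetters {m} w = length (filter (λ a → occurs? a w) (allFin m))

Good : ∀ {m n} → ℕ → Word m (suc n) → Set
Good k w = ¬ Contains1-21 w × ¬ Contains2-12 w × distinctLetters w ≡ k

good? : ∀ {m n} (k : ℕ) (w : Word m (suc n)) → Dec (Good k w)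
good? k w = ¬? (contains1-21? w) ×-dec (¬? (contains2-12? w) ×-dec (distinctLetters w Data.Nat.≟ k))
  where import Data.Nat

falling : ℕ → ℕ → ℕ
falling a zero = 1
falling a (suc b) = a * falling (a ∸ 1) b

-- Call a word good (for k) if it avoids 1-21 and 2-12 and has exactly k
-- distinct letters.  A word avoids both patterns exactly when it is "blocky":
-- a letter that reappears is always immediately preceded by itself, i.e. the
-- occurrences of each letter are consecutive.  Blockiness is easy to control
-- when a letter a is prepended to a word w: the word a w is blocky iff w is
-- blocky and either a is the first letter of w (same letters) or a does not
-- occur in w (one new letter).  Writing S n k (goodCount) for the number of
-- good words of length n+1 with k letters and summing this rule over the m
-- choices of a gives the recurrence
--     S (n+1) k = S n k + (m - (k-1)) · S n (k-1),
-- and with S 0 k = m·[k = 1] induction yields S n k = (m)_k · C(n, k-1).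
-- Finally (m)_k = C(m,k)·k! turns this into C(m,k)·k·(n)_{k-1}.

module Submission where

open import Data.Nat using (ℕ; zero; suc; _+_; _*_; _∸_; _≤_; _<_; _!; z≤n; s≤s)
import Data.Nat as ℕ
open import Data.Nat.Properties
  using (+-identityʳ; +-assoc; *-identityˡ; *-identityʳ; *-zeroʳ; *-comm; *-assoc;
         *-distribˡ-+; *-distribʳ-+; m+n∸n≡m; ∸-+-assoc; suc-injective; ≰⇒>;
         _!≢0; +-commutativeSemigroup)
open import Data.Nat.Combinatorics
  using (_C_; _P_; k>n⇒nCk≡0; nCk≡nPk/k!; nPk≡n!/[n∸k]!; nCk+nC[k+1]≡[n+1]C[k+1])
open import Data.Nat.Combinatorics.Base using (_P′_)
open import Data.Nat.Combinatorics.Specification using (k!∣nP′k; nP′k≡n!/[n∸k]!)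
open import Data.Nat.DivMod using (_/_; m/n*n≡m; /-congˡ)
open import Data.Nat.Solver using (module +-*-Solver)
open import Algebra.Properties.CommutativeSemigroup +-commutativeSemigroup
  using (interchange)
open import Data.Fin using (Fin; zero; suc; inject₁)
import Data.Fin as F
open import Data.Fin.Properties using (_≟_; <-cmp; <-irrefl)
import Data.Fin.Properties as Fin
open import Data.List using (List; []; _∷_; _++_; length; filter; map; concatMap; allFin)
open import Data.List.Properties using (length-tabulate; map-tabulate)
open import Data.Product using (∃-syntax; _×_; _,_)
open import Data.Sum using (_⊎_; inj₁; inj₂; [_,_])
open import Data.Empty using (⊥-elim)
open import Relation.Nullary using (¬_; Dec; yes; no; ¬?)
open import Relation.Nullary.Decidable using (_×-dec_)
open import Function.Bundles using (_⇔_; mk⇔; module Equivalence)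
open import Relation.Binary.Definitions using (tri<; tri≈; tri>)
open import Relation.Binary.PropositionalEquality
  using (_≡_; _≢_; refl; sym; trans; cong; cong₂; module ≡-Reasoning)

open import Defs

private
  variable
    m n : ℕ
    A B : Set

𝟙 : {P : Set} → Dec P → ℕ
𝟙 (yes _) = 1
𝟙 (no _)  = 0

𝟙-yes : {P : Set} (p : Dec P) → P → 𝟙 p ≡ 1
𝟙-yes (yes _) _  = refl
𝟙-yes (no ¬p) p  = ⊥-elim (¬p p)

𝟙-no : {P : Set} (p : Dec P) → ¬ P → 𝟙 p ≡ 0
𝟙-no (yes p) ¬p = ⊥-elim (¬p p)
𝟙-no (no _)  _  = refl

𝟙-⇔ : {P Q : Set} (p : Dec P) (q : Dec Q) → (P → Q) → (Q → P) → 𝟙 p ≡ 𝟙 q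
𝟙-⇔ (yes _) (yes _) _ _ = refl
𝟙-⇔ (yes p) (no ¬q) f _ = ⊥-elim (¬q (f p))
𝟙-⇔ (no ¬p) (yes q) _ g = ⊥-elim (¬p (g q))
𝟙-⇔ (no _)  (no _)  _ _ = refl

𝟙-× : {P Q : Set} (p : Dec P) (q : Dec Q) → 𝟙 (p ×-dec q) ≡ 𝟙 p * 𝟙 q
𝟙-× (yes _) (yes _) = refl
𝟙-× (yes _) (no _)  = refl
𝟙-× (no _)  _       = refl

𝟙-⊎ : {P Q R : Set} (p : Dec P) (q : Dec Q) (r : Dec R) →
      (P → Q ⊎ R) → (Q ⊎ R → P) → ¬ (Q × R) → 𝟙 p ≡ 𝟙 q + 𝟙 r
𝟙-⊎ _       (yes q) (yes r) _ _ disj = ⊥-elim (disj (q , r))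
𝟙-⊎ (yes _) (yes _) (no _)  _ _ _    = refl
𝟙-⊎ (yes _) (no _)  (yes _) _ _ _    = refl
𝟙-⊎ (yes p) (no ¬q) (no ¬r) f _ _ with f p
... | inj₁ q = ⊥-elim (¬q q)
... | inj₂ r = ⊥-elim (¬r r)
𝟙-⊎ (no ¬p) (yes q) (no _)  _ g _    = ⊥-elim (¬p (g (inj₁ q)))
𝟙-⊎ (no ¬p) (no _)  (yes r) _ g _    = ⊥-elim (¬p (g (inj₂ r)))
𝟙-⊎ (no _)  (no _)  (no _)  _ _ _    = refl

𝟙-¬ : {P : Set} (p : Dec P) → 𝟙 (¬? p) + 𝟙 p ≡ 1
𝟙-¬ (yes _) = refl
𝟙-¬ (no _)  = refl

weight-at : (f : ℕ → ℕ) (x d k : ℕ) →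
            f d * (x * 𝟙 (d ℕ.≟ k)) ≡ f k * (x * 𝟙 (d ℕ.≟ k))
weight-at f x d k with d ℕ.≟ k
... | yes refl = refl
... | no _     = trans (cong (f d *_) (*-zeroʳ x))
                   (trans (*-zeroʳ (f d)) (sym (trans (cong (f k *_) (*-zeroʳ x)) (*-zeroʳ (f k)))))

sumOver : List A → (A → ℕ) → ℕ
sumOver []       f = 0
sumOver (x ∷ xs) f = f x + sumOver xs f

syntax sumOver xs (λ x → e) = ∑[ x ← xs ] e

∑-cong : (xs : List A) {f g : A → ℕ} → (∀ x → f x ≡ g x) → sumOver xs f ≡ sumOver xs g
∑-cong []       _  = refl
∑-cong (x ∷ xs) eq = cong₂ _+_ (eq x) (∑-cong xs eq)

∑-++ : (xs ys : List A) (f : A → ℕ) → sumOver (xs ++ ys) f ≡ sumOver xs f + sumOver ys f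
∑-++ []       ys f = refl
∑-++ (x ∷ xs) ys f = trans (cong (f x +_) (∑-++ xs ys f)) (sym (+-assoc (f x) _ _))

∑-map : (h : A → B) (xs : List A) (f : B → ℕ) →
        sumOver (map h xs) f ≡ ∑[ x ← xs ] f (h x)
∑-map h []       f = refl
∑-map h (x ∷ xs) f = cong (f (h x) +_) (∑-map h xs f)

∑-concatMap : (g : A → List B) (xs : List A) (f : B → ℕ) →
              sumOver (concatMap g xs) f ≡ ∑[ x ← xs ] sumOver (g x) f
∑-concatMap g []       f = refl
∑-concatMap g (x ∷ xs) f =
  trans (∑-++ (g x) (concatMap g xs) f) (cong (sumOver (g x) f +_) (∑-concatMap g xs f))

∑-+ : (xs : List A) (f g : A → ℕ) →
      ∑[ x ← xs ] (f x + g x) ≡ sumOver xs f + sumOver xs g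
∑-+ []       f g = refl
∑-+ (x ∷ xs) f g =
  trans (cong (f x + g x +_) (∑-+ xs f g)) (interchange (f x) (g x) _ _)

∑-*ˡ : (c : ℕ) (xs : List A) (f : A → ℕ) → ∑[ x ← xs ] (c * f x) ≡ c * sumOver xs f
∑-*ˡ c []       f = sym (*-zeroʳ c)
∑-*ˡ c (x ∷ xs) f =
  trans (cong (c * f x +_) (∑-*ˡ c xs f)) (sym (*-distribˡ-+ c (f x) _))

∑-*ʳ : (c : ℕ) (xs : List A) (f : A → ℕ) → ∑[ x ← xs ] (f x * c) ≡ sumOver xs f * c
∑-*ʳ c []       f = refl
∑-*ʳ c (x ∷ xs) f =
  trans (cong (f x * c +_) (∑-*ʳ c xs f)) (sym (*-distribʳ-+ c (f x) _))

∑-const : (xs : List A) (c : ℕ) → ∑[ x ← xs ] c ≡ length xs * c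
∑-const []       c = refl
∑-const (x ∷ xs) c = cong (c +_) (∑-const xs c)

∑-comm : (xs : List A) (ys : List B) (f : A → B → ℕ) →
         ∑[ x ← xs ] ∑[ y ← ys ] f x y ≡ ∑[ y ← ys ] ∑[ x ← xs ] f x y
∑-comm []       ys f = sym (trans (∑-const ys 0) (*-zeroʳ (length ys)))
∑-comm (x ∷ xs) ys f =
  trans (cong (sumOver ys (f x) +_) (∑-comm xs ys f))
        (sym (∑-+ ys (f x) (λ y → ∑[ x′ ← xs ] f x′ y)))

count≡∑𝟙 : {P : A → Set} (P? : ∀ x → Dec (P x)) (xs : List A) →
           length (filter P? xs) ≡ ∑[ x ← xs ] 𝟙 (P? x)
count≡∑𝟙 P? []       = refl
count≡∑𝟙 P? (x ∷ xs) with P? x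
... | yes _ = cong suc (count≡∑𝟙 P? xs)
... | no _  = count≡∑𝟙 P? xs

∑-complement : {P : A → Set} (P? : ∀ x → Dec (P x)) (xs : List A) →
               ∑[ x ← xs ] 𝟙 (¬? (P? x)) ≡ length xs ∸ ∑[ x ← xs ] 𝟙 (P? x)
∑-complement P? xs = begin
    ∑[ x ← xs ] 𝟙 (¬? (P? x))
  ≡⟨ sym (m+n∸n≡m _ (∑[ x ← xs ] 𝟙 (P? x))) ⟩
    ∑[ x ← xs ] 𝟙 (¬? (P? x)) + ∑[ x ← xs ] 𝟙 (P? x) ∸ ∑[ x ← xs ] 𝟙 (P? x)
  ≡⟨ cong (_∸ ∑[ x ← xs ] 𝟙 (P? x)) (sym (∑-+ xs _ _)) ⟩
    ∑[ x ← xs ] (𝟙 (¬? (P? x)) + 𝟙 (P? x)) ∸ ∑[ x ← xs ] 𝟙 (P? x)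
  ≡⟨ cong (_∸ ∑[ x ← xs ] 𝟙 (P? x))
          (trans (∑-cong xs (λ x → 𝟙-¬ (P? x))) (trans (∑-const xs 1) (*-identityʳ _))) ⟩
    length xs ∸ ∑[ x ← xs ] 𝟙 (P? x) ∎
  where open ≡-Reasoning

∑-allFin-δ : (a : Fin m) → ∑[ b ← allFin m ] 𝟙 (b ≟ a) ≡ 1
∑-allFin-δ {suc m} a = begin
    ∑[ b ← allFin (suc m) ] 𝟙 (b ≟ a)
  ≡⟨ cong (λ bs → 𝟙 (zero ≟ a) + sumOver bs (λ b → 𝟙 (b ≟ a))) (sym (map-tabulate (λ i → i) suc)) ⟩
    𝟙 (zero ≟ a) + sumOver (map suc (allFin m)) (λ b → 𝟙 (b ≟ a))
  ≡⟨ cong (𝟙 (zero ≟ a) +_) (∑-map suc (allFin m) (λ b → 𝟙 (b ≟ a))) ⟩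
    𝟙 (zero ≟ a) + ∑[ b ← allFin m ] 𝟙 (suc b ≟ a)
  ≡⟨ head-and-tail a ⟩
    1 ∎
  where
  open ≡-Reasoning
  head-and-tail : (a : Fin (suc m)) → 𝟙 (zero ≟ a) + ∑[ b ← allFin m ] 𝟙 (suc b ≟ a) ≡ 1
  head-and-tail zero    = cong suc (trans (∑-cong (allFin m) (λ b → 𝟙-no (suc b ≟ zero) (λ ())))
                                          (trans (∑-const (allFin m) 0) (*-zeroʳ (length (allFin m)))))
  head-and-tail (suc a) = trans (∑-cong (allFin m) (λ b →
                                  𝟙-⇔ (suc b ≟ suc a) (b ≟ a) Fin.suc-injective (cong suc)))
                                (∑-allFin-δ a)

length-allFin : ∀ m → length (allFin m) ≡ m
length-allFin m = length-tabulate (λ i → i)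

tail : Word m (suc n) → Word m n
tail v i = v (suc i)

∑-allWords : (g : Fin m → Word m n → ℕ) →
             ∑[ v ← allWords m (suc n) ] g (v zero) (tail v) ≡
             ∑[ a ← allFin m ] ∑[ w ← allWords m n ] g a w
∑-allWords {m} {n} g =
  trans (∑-concatMap _ (allFin m) _) (∑-cong (allFin m) (λ a → ∑-map _ (allWords m n) _))

Avoids : Word m (suc n) → Set
Avoids w = ¬ Contains1-21 w × ¬ Contains2-12 w

avoids? : (w : Word m (suc n)) → Dec (Avoids w)
avoids? w = ¬? (contains1-21? w) ×-dec ¬? (contains2-12? w)

𝟙-good : (k : ℕ) (w : Word m (suc n)) →
         𝟙 (good? k w) ≡ 𝟙 (avoids? w) * 𝟙 (distinctLetters w ℕ.≟ k)
𝟙-good k w = trans (𝟙-⇔ (good? k w) (avoids? w ×-dec (distinctLetters w ℕ.≟ k))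
                        (λ (a , b , c) → (a , b) , c) (λ ((a , b) , c) → a , b , c))
                   (𝟙-× (avoids? w) (distinctLetters w ℕ.≟ k))

-- Every letter reappearing at position j+1 after an earlier occurrence is
-- preceded by itself; equivalently the occurrences of each letter are consecutive.
Blocky : Word m (suc n) → Set
Blocky {n = n} w = ∀ (i : Fin (suc n)) (j : Fin n) →
  i F.< inject₁ j → w i ≡ w (suc j) → w (suc j) ≡ w (inject₁ j)

-- Avoiding 1-21 and 2-12 is exactly blockiness, by trichotomy of w (j+1) vs w j.
avoids⇒blocky : (w : Word m (suc n)) → Avoids w → Blocky w
avoids⇒blocky w (¬1-21 , ¬2-12) i j i<j same with <-cmp (w (suc j)) (w (inject₁ j))
... | tri< lt _ _ = ⊥-elim (¬1-21 (i , j , i<j , same , lt))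
... | tri≈ _ eq _ = eq
... | tri> _ _ gt = ⊥-elim (¬2-12 (i , j , i<j , same , gt))

blocky⇒avoids : (w : Word m (suc n)) → Blocky w → Avoids w
blocky⇒avoids w b = (λ (i , j , i<j , same , lt) → <-irrefl (b i j i<j same) lt)
                  , (λ (i , j , i<j , same , gt) → <-irrefl (sym (b i j i<j same)) gt)

entry-point : {a : Fin m} (w : Word m (suc n)) → Occurs a w → w zero ≢ a →
              ∃[ j ] (w (suc j) ≡ a × w (inject₁ j) ≢ a)
entry-point w (zero , eq) ≢a = ⊥-elim (≢a eq)
entry-point {n = suc n} {a = a} w (suc p , eq) ≢a with w (suc zero) ≟ a
... | yes eq₁ = zero , eq₁ , ≢a
... | no ≢a₁ with entry-point (tail w) (p , eq) ≢a₁
...   | j , eqj , ≢aj = suc j , eqj , ≢aj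

blocky-tail : (v : Word m (suc (suc n))) → Blocky v → Blocky (tail v)
blocky-tail v b i j i<j same = b (suc i) (suc j) (s≤s i<j) same

blocky-head : (v : Word m (suc (suc n))) → Blocky v →
              v zero ≡ v (suc zero) ⊎ ¬ Occurs (v zero) (tail v)
blocky-head v b with v zero ≟ v (suc zero)
... | yes eq = inj₁ eq
... | no differs = inj₂ λ occ → reentered (entry-point (tail v) occ (λ eq → differs (sym eq)))
  where
  reentered : ¬ (∃[ j ] (v (suc (suc j)) ≡ v zero × v (suc (inject₁ j)) ≢ v zero))
  reentered (j , eq , ≢j) = ≢j (trans (sym (b zero (suc j) (s≤s z≤n) (sym eq))) eq)

blocky-cons : (v : Word m (suc (suc n))) → Blocky (tail v) →
              v zero ≡ v (suc zero) ⊎ ¬ Occurs (v zero) (tail v) → Blocky v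
blocky-cons v b _ i zero () _
blocky-cons v b _ (suc i) (suc j) (s≤s i<j) same = b i j i<j same
blocky-cons v b (inj₂ fresh) zero (suc j) _ same = ⊥-elim (fresh (suc j , sym same))
blocky-cons v b (inj₁ rep) zero (suc zero) _ same = trans (sym same) rep
blocky-cons v b (inj₁ rep) zero (suc (suc j)) _ same =
  b zero (suc j) (s≤s z≤n) (trans (sym rep) same)

distinct-cons : (v : Word m (suc n)) →
  distinctLetters v ≡ 𝟙 (¬? (occurs? (v zero) (tail v))) + distinctLetters (tail v)
distinct-cons {m} {n} v = begin
    distinctLetters v
  ≡⟨ count≡∑𝟙 (λ b → occurs? b v) (allFin m) ⟩
    ∑[ b ← allFin m ] 𝟙 (occurs? b v)
  ≡⟨ ∑-cong (allFin m) (λ b → 𝟙-⊎ (occurs? b v) (b ≟ a ×-dec new?) (occurs? b w)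
                                  (split b) (join b) (λ { ((refl , new) , occ) → new occ })) ⟩
    ∑[ b ← allFin m ] (𝟙 (b ≟ a ×-dec new?) + 𝟙 (occurs? b w))
  ≡⟨ ∑-+ (allFin m) _ _ ⟩
    ∑[ b ← allFin m ] 𝟙 (b ≟ a ×-dec new?) + ∑[ b ← allFin m ] 𝟙 (occurs? b w)
  ≡⟨ cong₂ _+_ (trans (∑-cong (allFin m) (λ b → 𝟙-× (b ≟ a) new?))
                      (trans (∑-*ʳ (𝟙 new?) (allFin m) _)
                             (trans (cong (_* 𝟙 new?) (∑-allFin-δ a)) (*-identityˡ _))))
               (sym (count≡∑𝟙 (λ b → occurs? b w) (allFin m))) ⟩
    𝟙 new? + distinctLetters w ∎
  where
  open ≡-Reasoning
  a : Fin m
  a = v zero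
  w : Word m n
  w = tail v
  new? : Dec (¬ Occurs a w)
  new? = ¬? (occurs? a w)
  split : ∀ b → Occurs b v → (b ≡ a × ¬ Occurs a w) ⊎ Occurs b w
  split b (suc i , eq) = inj₂ (i , eq)
  split b (zero , refl) with occurs? a w
  ... | yes occ = inj₂ occ
  ... | no new  = inj₁ (refl , new)
  join : ∀ b → (b ≡ a × ¬ Occurs a w) ⊎ Occurs b w → Occurs b v
  join b (inj₁ (refl , _)) = zero , refl
  join b (inj₂ (i , eq))   = suc i , eq

distinct-old : (v : Word m (suc n)) → Occurs (v zero) (tail v) →
               distinctLetters v ≡ distinctLetters (tail v)
distinct-old v occ = trans (distinct-cons v)
  (cong (_+ distinctLetters (tail v)) (𝟙-no (¬? (occurs? (v zero) (tail v))) (λ new → new occ)))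

distinct-new : (v : Word m (suc n)) → ¬ Occurs (v zero) (tail v) →
               distinctLetters v ≡ suc (distinctLetters (tail v))
distinct-new v new = trans (distinct-cons v)
  (cong (_+ distinctLetters (tail v)) (𝟙-yes (¬? (occurs? (v zero) (tail v))) new))

good-cons : (k : ℕ) (v : Word m (suc (suc n))) →
  Good k v ⇔ ((v zero ≡ v (suc zero) × Good k (tail v)) ⊎
               (¬ Occurs (v zero) (tail v) × Avoids (tail v) × suc (distinctLetters (tail v)) ≡ k))
good-cons {m} {n} k v = mk⇔ forward backward
  where
  w : Word m (suc n)
  w = tail v
  Repeated New : Set
  Repeated = v zero ≡ v (suc zero) × Good k w
  New      = ¬ Occurs (v zero) w × Avoids w × suc (distinctLetters w) ≡ k
  forward : Good k v → Repeated ⊎ New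
  forward (¬1-21 , ¬2-12 , dv≡k) =
    let blocky-v          = avoids⇒blocky v (¬1-21 , ¬2-12)
        (¬1-21′ , ¬2-12′) = blocky⇒avoids w (blocky-tail v blocky-v)
    in [ (λ rep → inj₁ (rep , ¬1-21′ , ¬2-12′ , trans (sym (distinct-old v (zero , sym rep))) dv≡k))
       , (λ new → inj₂ (new , (¬1-21′ , ¬2-12′) , trans (sym (distinct-new v new)) dv≡k))
       ] (blocky-head v blocky-v)
  backward : Repeated ⊎ New → Good k v
  backward (inj₁ (rep , ¬1-21 , ¬2-12 , dw≡k)) =
    let (a , b) = blocky⇒avoids v (blocky-cons v (avoids⇒blocky w (¬1-21 , ¬2-12)) (inj₁ rep))
    in a , b , trans (distinct-old v (zero , sym rep)) dw≡k
  backward (inj₂ (new , av , sdw≡k)) =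
    let (a , b) = blocky⇒avoids v (blocky-cons v (avoids⇒blocky w av) (inj₂ new))
    in a , b , trans (distinct-new v new) sdw≡k

-- Contribution of the word a w (first letter a, tail w) to the good words with
-- k letters: a repeats the first letter of a good w, or a is a new letter and
-- w avoids the patterns with k-1 letters.
prependWeight : (k : ℕ) → Fin m → Word m (suc n) → ℕ
prependWeight k a w =
  𝟙 (a ≟ w zero) * 𝟙 (good? k w) +
  𝟙 (¬? (occurs? a w)) * (𝟙 (avoids? w) * 𝟙 (suc (distinctLetters w) ℕ.≟ k))

-- Indicator form of good-cons; its alternatives are disjoint, since a repeated
-- first letter occurs in the tail.
good-step : (k : ℕ) (v : Word m (suc (suc n))) →
            𝟙 (good? k v) ≡ prependWeight k (v zero) (tail v)
good-step {m} {n} k v = begin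
    𝟙 (good? k v)
  ≡⟨ 𝟙-⊎ (good? k v) repeated? new? to from
         (λ ((rep , _) , (new , _)) → new (zero , sym rep)) ⟩
    𝟙 repeated? + 𝟙 new?
  ≡⟨ cong₂ _+_ (𝟙-× (v zero ≟ w zero) (good? k w))
               (trans (𝟙-× (¬? (occurs? (v zero) w)) _)
                      (cong (𝟙 (¬? (occurs? (v zero) w)) *_) (𝟙-× (avoids? w) _))) ⟩
    prependWeight k (v zero) w ∎
  where
  open ≡-Reasoning
  open Equivalence (good-cons k v)
  w : Word m (suc n)
  w = tail v
  repeated? : Dec (v zero ≡ w zero × Good k w)
  repeated? = v zero ≟ w zero ×-dec good? k w
  new? : Dec (¬ Occurs (v zero) w × Avoids w × suc (distinctLetters w) ≡ k)
  new? = ¬? (occurs? (v zero) w) ×-dec (avoids? w ×-dec (suc (distinctLetters w) ℕ.≟ k))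

new-letters : (w : Word m n) → ∑[ a ← allFin m ] 𝟙 (¬? (occurs? a w)) ≡ m ∸ distinctLetters w
new-letters {m} w = trans (∑-complement (λ a → occurs? a w) (allFin m))
  (cong₂ _∸_ (length-allFin m) (sym (count≡∑𝟙 (λ a → occurs? a w) (allFin m))))

newLetterWeight : (k : ℕ) → Word m (suc n) → ℕ
newLetterWeight {m} k w =
  (m ∸ distinctLetters w) * (𝟙 (avoids? w) * 𝟙 (suc (distinctLetters w) ℕ.≟ k))

-- Summing over the first letter: one repeating letter plus the new letters.
∑-prependWeight : (k : ℕ) (w : Word m (suc n)) →
  ∑[ a ← allFin m ] prependWeight k a w ≡ 𝟙 (good? k w) + newLetterWeight k w
∑-prependWeight {m} k w = begin
    ∑[ a ← allFin m ] prependWeight k a w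
  ≡⟨ ∑-+ (allFin m) _ _ ⟩
    ∑[ a ← allFin m ] (𝟙 (a ≟ w zero) * G) + ∑[ a ← allFin m ] (𝟙 (¬? (occurs? a w)) * Y)
  ≡⟨ cong₂ _+_ (∑-*ʳ G (allFin m) _) (∑-*ʳ Y (allFin m) _) ⟩
    ∑[ a ← allFin m ] 𝟙 (a ≟ w zero) * G + ∑[ a ← allFin m ] 𝟙 (¬? (occurs? a w)) * Y
  ≡⟨ cong₂ _+_ (trans (cong (_* G) (∑-allFin-δ (w zero))) (*-identityˡ G))
               (cong (_* Y) (new-letters w)) ⟩
    G + newLetterWeight k w ∎
  where
  open ≡-Reasoning
  G Y : ℕ
  G = 𝟙 (good? k w)
  Y = 𝟙 (avoids? w) * 𝟙 (suc (distinctLetters w) ℕ.≟ k)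

newLetterWeight-zero : (w : Word m (suc n)) → newLetterWeight 0 w ≡ 0
newLetterWeight-zero {m} w =
  trans (cong (λ x → (m ∸ distinctLetters w) * (𝟙 (avoids? w) * x))
              (𝟙-no (suc (distinctLetters w) ℕ.≟ 0) (λ ())))
        (trans (cong ((m ∸ distinctLetters w) *_) (*-zeroʳ (𝟙 (avoids? w))))
               (*-zeroʳ (m ∸ distinctLetters w)))

newLetterWeight-suc : (k : ℕ) (w : Word m (suc n)) →
                      newLetterWeight (suc k) w ≡ (m ∸ k) * 𝟙 (good? k w)
newLetterWeight-suc {m} k w = begin
    (m ∸ d) * (𝟙 (avoids? w) * 𝟙 (suc d ℕ.≟ suc k))
  ≡⟨ cong (λ x → (m ∸ d) * (𝟙 (avoids? w) * x))
          (𝟙-⇔ (suc d ℕ.≟ suc k) (d ℕ.≟ k) suc-injective (cong suc)) ⟩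
    (m ∸ d) * (𝟙 (avoids? w) * 𝟙 (d ℕ.≟ k))
  ≡⟨ weight-at (m ∸_) (𝟙 (avoids? w)) d k ⟩
    (m ∸ k) * (𝟙 (avoids? w) * 𝟙 (d ℕ.≟ k))
  ≡⟨ cong ((m ∸ k) *_) (sym (𝟙-good k w)) ⟩
    (m ∸ k) * 𝟙 (good? k w) ∎
  where
  open ≡-Reasoning
  d : ℕ
  d = distinctLetters w

goodCount : (m n k : ℕ) → ℕ
goodCount m n k = ∑[ w ← allWords m (suc n) ] 𝟙 (good? k w)

goodCount-step : ∀ m n k → goodCount m (suc n) k ≡
                 goodCount m n k + ∑[ w ← allWords m (suc n) ] newLetterWeight k w
goodCount-step m n k = begin
    ∑[ v ← allWords m (suc (suc n)) ] 𝟙 (good? k v)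
  ≡⟨ ∑-cong (allWords m (suc (suc n))) (good-step k) ⟩
    ∑[ v ← allWords m (suc (suc n)) ] prependWeight k (v zero) (tail v)
  ≡⟨ ∑-allWords {m} {suc n} (prependWeight k) ⟩
    ∑[ a ← allFin m ] ∑[ w ← ws ] prependWeight k a w
  ≡⟨ ∑-comm (allFin m) ws (prependWeight k) ⟩
    ∑[ w ← ws ] ∑[ a ← allFin m ] prependWeight k a w
  ≡⟨ ∑-cong ws (∑-prependWeight k) ⟩
    ∑[ w ← ws ] (𝟙 (good? k w) + newLetterWeight k w)
  ≡⟨ ∑-+ ws _ _ ⟩
    goodCount m n k + ∑[ w ← ws ] newLetterWeight k w ∎
  where
  open ≡-Reasoning
  ws : List (Word m (suc n))
  ws = allWords m (suc n)

goodCount-suc-zero : ∀ m n → goodCount m (suc n) 0 ≡ goodCount m n 0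
goodCount-suc-zero m n =
  trans (goodCount-step m n 0)
    (trans (cong (goodCount m n 0 +_)
                 (trans (∑-cong ws newLetterWeight-zero) (trans (∑-const ws 0) (*-zeroʳ (length ws)))))
           (+-identityʳ _))
  where
  ws : List (Word m (suc n))
  ws = allWords m (suc n)

goodCount-suc-suc : ∀ m n k →
  goodCount m (suc n) (suc k) ≡ goodCount m n (suc k) + (m ∸ k) * goodCount m n k
goodCount-suc-suc m n k =
  trans (goodCount-step m n (suc k))
    (cong (goodCount m n (suc k) +_)
          (trans (∑-cong ws (newLetterWeight-suc k)) (∑-*ˡ (m ∸ k) ws _)))
  where
  ws : List (Word m (suc n))
  ws = allWords m (suc n)

single-letter-good : (k : ℕ) (v : Word m 1) → 𝟙 (good? k v) ≡ 𝟙 (1 ℕ.≟ k)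
single-letter-good {m} k v = 𝟙-⇔ (good? k v) (1 ℕ.≟ k)
  (λ (_ , _ , d≡k) → trans (sym one-letter) d≡k)
  (λ 1≡k → let (¬1-21 , ¬2-12) = blocky⇒avoids v (λ _ ()) in ¬1-21 , ¬2-12 , trans one-letter 1≡k)
  where
  one-letter : distinctLetters v ≡ 1
  one-letter = trans (count≡∑𝟙 (λ b → occurs? b v) (allFin m))
    (trans (∑-cong (allFin m) (λ b → 𝟙-⇔ (occurs? b v) (b ≟ v zero)
                                        (λ { (zero , eq) → sym eq }) (λ eq → zero , sym eq)))
           (∑-allFin-δ (v zero)))

goodCount-zero : ∀ m k → goodCount m 0 k ≡ m * 𝟙 (1 ℕ.≟ k)
goodCount-zero m k = begin
    ∑[ v ← allWords m 1 ] 𝟙 (good? k v)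
  ≡⟨ ∑-cong (allWords m 1) (single-letter-good k) ⟩
    ∑[ v ← allWords m 1 ] c
  ≡⟨ ∑-allWords {m} {0} (λ _ _ → c) ⟩
    ∑[ a ← allFin m ] (c + 0)
  ≡⟨ ∑-cong (allFin m) (λ _ → +-identityʳ c) ⟩
    ∑[ a ← allFin m ] c
  ≡⟨ trans (∑-const (allFin m) c) (cong (_* c) (length-allFin m)) ⟩
    m * c ∎
  where
  open ≡-Reasoning
  c : ℕ
  c = 𝟙 (1 ℕ.≟ k)

falling-snoc : ∀ a b → falling a (suc b) ≡ falling a b * (a ∸ b)
falling-snoc a zero    = trans (*-identityʳ a) (sym (+-identityʳ a))
falling-snoc a (suc b) = begin
    a * falling (a ∸ 1) (suc b)
  ≡⟨ cong (a *_) (falling-snoc (a ∸ 1) b) ⟩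
    a * (falling (a ∸ 1) b * (a ∸ 1 ∸ b))
  ≡⟨ cong (λ x → a * (falling (a ∸ 1) b * x)) (∸-+-assoc a 1 b) ⟩
    a * (falling (a ∸ 1) b * (a ∸ suc b))
  ≡⟨ sym (*-assoc a _ _) ⟩
    a * falling (a ∸ 1) b * (a ∸ suc b) ∎
  where open ≡-Reasoning

falling≡P′ : ∀ a b → falling a b ≡ a P′ b
falling≡P′ a zero    = refl
falling≡P′ a (suc b) =
  trans (falling-snoc a b) (trans (*-comm (falling a b) (a ∸ b)) (cong ((a ∸ b) *_) (falling≡P′ a b)))

falling-vanishes : ∀ a b → a < b → falling a b ≡ 0
falling-vanishes zero    (suc b) _         = refl
falling-vanishes (suc a) (suc b) (s≤s a<b) =
  trans (cong (suc a *_) (falling-vanishes a b a<b)) (*-zeroʳ (suc a))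

falling≡C*! : ∀ a b → falling a b ≡ (a C b) * b !
falling≡C*! a b with b ℕ.≤? a
... | no b≰a = trans (falling-vanishes a b (≰⇒> b≰a)) (sym (cong (_* b !) (k>n⇒nCk≡0 (≰⇒> b≰a))))
... | yes b≤a = begin
    falling a b
  ≡⟨ falling≡P′ a b ⟩
    a P′ b
  ≡⟨ sym (m/n*n≡m (k!∣nP′k b≤a)) ⟩
    ((a P′ b) / b !) * b !
  ≡⟨ cong (_* b !) (sym (/-congˡ P≡P′)) ⟩
    ((a P b) / b !) * b !
  ≡⟨ cong (_* b !) (sym (nCk≡nPk/k! b≤a)) ⟩
    (a C b) * b ! ∎
  where
  open ≡-Reasoning
  instance _ = b !≢0
  P≡P′ : a P b ≡ a P′ b
  P≡P′ = trans (nPk≡n!/[n∸k]! b≤a) (sym (nP′k≡n!/[n∸k]! b≤a))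

closedForm : (m n k : ℕ) → ℕ
closedForm m n zero    = 0
closedForm m n (suc k) = falling m (suc k) * (n C k)

closedForm-zero : ∀ m k → m * 𝟙 (1 ℕ.≟ k) ≡ closedForm m 0 k
closedForm-zero m zero          = *-zeroʳ m
closedForm-zero m (suc zero)    = sym (*-identityʳ (m * 1))
closedForm-zero m (suc (suc k)) =
  trans (*-zeroʳ m) (sym (*-zeroʳ (falling m (suc (suc k)))))

-- The closed form satisfies the same recurrence, by Pascal's rule.
closedForm-step : ∀ m n k →
  closedForm m (suc n) (suc k) ≡ closedForm m n (suc k) + (m ∸ k) * closedForm m n k
closedForm-step m n zero    =
  sym (trans (cong (falling m 1 * 1 +_) (*-zeroʳ m)) (+-identityʳ (falling m 1 * 1)))
closedForm-step m n (suc j) = begin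
    falling m (suc (suc j)) * (suc n C suc j)
  ≡⟨ cong₂ _*_ (falling-snoc m (suc j)) (sym (nCk+nC[k+1]≡[n+1]C[k+1] n j)) ⟩
    F * D * (L + R)
  ≡⟨ solve 4 (λ F D L R → F :* D :* (L :+ R) := F :* D :* R :+ D :* (F :* L)) refl F D L R ⟩
    F * D * R + D * (F * L)
  ≡⟨ cong (_+ D * (F * L)) (cong (_* R) (sym (falling-snoc m (suc j)))) ⟩
    falling m (suc (suc j)) * R + D * (F * L) ∎
  where
  open ≡-Reasoning
  open +-*-Solver
  F D L R : ℕ
  F = falling m (suc j)
  D = m ∸ suc j
  L = n C j
  R = n C suc j

goodCount≡closedForm : ∀ m n k → goodCount m n k ≡ closedForm m n k
goodCount≡closedForm m zero    k       = trans (goodCount-zero m k) (closedForm-zero m k)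
goodCount≡closedForm m (suc n) zero    =
  trans (goodCount-suc-zero m n) (goodCount≡closedForm m n zero)
goodCount≡closedForm m (suc n) (suc k) =
  trans (goodCount-suc-suc m n k)
        (trans (cong₂ (λ x y → x + (m ∸ k) * y) (goodCount≡closedForm m n (suc k))
                                                 (goodCount≡closedForm m n k))
               (sym (closedForm-step m n k)))

mainTheorem5 : (m n' k : ℕ) → 1 ≤ m → 1 ≤ k → k ≤ m →
    length (filter (good? k) (allWords m (suc n'))) ≡ (m C k) * k * falling n' (k ∸ 1)
mainTheorem5 m n' zero    _ () _
mainTheorem5 m n' (suc k) _ _  _ = begin
    length (filter (good? (suc k)) (allWords m (suc n')))
  ≡⟨ count≡∑𝟙 (good? (suc k)) (allWords m (suc n')) ⟩
    goodCount m n' (suc k)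
  ≡⟨ goodCount≡closedForm m n' (suc k) ⟩
    falling m (suc k) * (n' C k)
  ≡⟨ cong (_* (n' C k)) (falling≡C*! m (suc k)) ⟩
    (m C suc k) * (suc k * k !) * (n' C k)
  ≡⟨ solve 4 (λ Cm sk kf Cn → Cm :* (sk :* kf) :* Cn := Cm :* sk :* (Cn :* kf))
           refl (m C suc k) (suc k) (k !) (n' C k) ⟩
    (m C suc k) * suc k * ((n' C k) * k !)
  ≡⟨ cong ((m C suc k) * suc k *_) (sym (falling≡C*! n' k)) ⟩
    (m C suc k) * suc k * falling n' k ∎
  where
  open ≡-Reasoning
  open +-*-Solver
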